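{- Let $W$ be an abelian group and $\mu$ a $W$-valued pseudo-measure. For $n\in\mathbb{Z}$ define $R_{\mu,n}:V_0\to W$ by $R_{\mu,n}(p,q)=\mu(n+a/p,\,n+b/q)$, where $a/p<b/q$ are the ends (in lowest terms, $p,q\ge1$) of the unique primitive segment contained in $[0,1]$ whose ends have denominators $p$ and $q$. Then: (a) each $R_{\mu,n}$ is a reciprocity function, i.e. $R_{\mu,n}(p+q,q)+R_{\mu,n}(p,p+q)=R_{\mu,n}(p,q)$ for all $(p,q)\in V_0$; (b) $R_{\mu,n}(1,1)=0$ if and only if $\mu(n,n+1)=0$.
   Context: $\mathbf{P}^1(\mathbb{Q})=\mathbb{Q}\cup\{\infty\}$. A $W$-valued pseudo-measure is a function $\mu:\mathbf{P}^1(\mathbb{Q})^2\to W$ with $\mu(\alpha,\alpha)=0$, $\mu(\alpha,\beta)+\mu(\beta,\alpha)=0$, $\mu(\alpha,\beta)+\mu(\beta,\gamma)+\mu(\gamma,\alpha)=0$ for all $\alpha,\beta,\gamma$. A primitive segment is an ordered pair $(\alpha,\beta)$ with $\alpha=a/c$, $\beta=b/d$ in lowest terms ($\infty=\pm1/0$) and $ad-bc=\pm1$. $V_0=\{(p,q)\in\mathbb{Z}^2:p,q\ge1,\gcd(p,q)=1\}$; the map sending a primitive segment $(a/p,b/q)\subset[0,1]$ ($a/p<b/q$, lowest terms, $p,q\ge1$) to $(p,q)$ is a bijection onto $V_0$. -}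

module Defs where

open import Level using (Level)
open import Relation.Binary.PropositionalEquality using (_≡_)
open import Algebra.Bundles using (AbelianGroup)
open import Data.Nat using (ℕ; zero; suc; _≤_; _*_) renaming (_+_ to _+ℕ_)
open import Data.Nat.Coprimality using (Coprime)
open import Data.Integer using (ℤ; +_)
open import Data.Rational using (ℚ; _/_) renaming (_+_ to _+ℚ_; _<_ to _<ℚ_)
open import Data.Product using (_×_)

data P1 : Set where
  fin : ℚ → P1
  ∞   : P1

-- a / d as a rational; only used with d ≥ 1 (the value at d = 0 is irrelevant junk)
frac : ℤ → ℕ → ℚ
frac a zero    = + 0 / 1
frac a (suc d) = a / suc d

ℤ→ℚ : ℤ → ℚ
ℤ→ℚ n = n / 1

module _ {c ℓ : Level} (W : AbelianGroup c ℓ) where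
  open AbelianGroup W

  record IsPseudoMeasure (μ : P1 → P1 → Carrier) : Set ℓ where
    field
      diag  : ∀ α → μ α α ≈ ε
      antis : ∀ α β → (μ α β ∙ μ β α) ≈ ε
      cocyc : ∀ α β γ → ((μ α β ∙ μ β γ) ∙ μ γ α) ≈ ε

  InV0 : ℕ → ℕ → Set
  InV0 p q = (1 ≤ p) × (1 ≤ q) × Coprime p q

  -- R : V₀ → W is a reciprocity function
  -- (R is given as a function on ℕ², only its values on V₀ matter)
  IsReciprocity : (ℕ → ℕ → Carrier) → Set ℓ
  IsReciprocity R = ∀ p q → InV0 p q →
    (R (p +ℕ q) q ∙ R p (p +ℕ q)) ≈ R p q

-- (a/p, b/q) is a primitive segment contained in [0,1] with a/p < b/q,
-- both ends in lowest terms, p, q ≥ 1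
-- (primitivity with a/p < b/q means b·p − a·q = 1, i.e. b·p = a·q + 1)
PrimSeg01 : (p q a b : ℕ) → Set
PrimSeg01 p q a b =
  (1 ≤ p) × (1 ≤ q) × Coprime a p × Coprime b q ×
  (b * p ≡ a * q +ℕ 1) × (b ≤ q)

module _ {c ℓ : Level} (W : AbelianGroup c ℓ) where
  open AbelianGroup W

  IsRμn : (μ : P1 → P1 → Carrier) (n : ℤ) (R : ℕ → ℕ → Carrier) → Set ℓ
  IsRμn μ n R = ∀ p q a b → PrimSeg01 p q a b →
    R p q ≈ μ (fin (ℤ→ℚ n +ℚ frac (+ a) p)) (fin (ℤ→ℚ n +ℚ frac (+ b) q))

{-# OPTIONS --safe #-}
-- The primitive segments in [0,1] are the nodes of the Stern–Brocot tree: every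
-- (p,q) ∈ V₀ other than (1,1) arises from a smaller pair by the subtractive Euclidean
-- algorithm, so the segment (a/p, b/q) exists, and its mediant (a+b)/(p+q) cuts it into
-- the primitive segments with denominator pairs (p, p+q) and (p+q, q). Additivity of μ
-- (the cocycle relation) across the mediant is then exactly the reciprocity relation,
-- and (0/1, 1/1) is the segment for (1,1).
module Submission where

open import Defs
open import Algebra.Bundles using (AbelianGroup)
open import Data.Nat using (ℕ)
open import Data.Integer using (ℤ; +_)
open import Data.Rational using (_/_) renaming (_+_ to _+ℚ_)
open import Data.Product using (_×_)

open import Data.Nat using (suc; _+_; _*_; _≤_; _<_; s≤s; z≤n; compare; less; equal; greater)
open import Data.Nat.Properties
open import Data.Nat.Induction using (<-wellFounded)
open import Data.Nat.Divisibility using (_∣_; ∣-refl; ∣1⇒≡1; ∣m∣n⇒∣m+n; ∣m+n∣m⇒∣n; ∣m⇒∣m*n; ∣n⇒∣m*n)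
open import Data.Nat.Coprimality using (Coprime)
open import Data.Nat.Tactic.RingSolver using (solve)
open import Data.List using (_∷_; [])
open import Data.Product using (_,_)
open import Induction.WellFounded using (Acc; acc)
open import Relation.Binary.PropositionalEquality using (_≡_; _≢_; refl; cong; subst; module ≡-Reasoning)
import Relation.Binary.PropositionalEquality as ≡
import Data.Rational.Properties as ℚ
import Algebra.Properties.Group as GroupProperties
import Relation.Binary.Reasoning.Setoid as SetoidReasoning

coprime-+⁻¹ˡ : ∀ {m n} → Coprime m (m + n) → Coprime m n
coprime-+⁻¹ˡ cop (d∣m , d∣n) = cop (d∣m , ∣m∣n⇒∣m+n d∣m d∣n)

coprime-+⁻¹ʳ : ∀ {m n} → Coprime (m + n) n → Coprime m n
coprime-+⁻¹ʳ cop (d∣m , d∣n) = cop (∣m∣n⇒∣m+n d∣m d∣n , d∣n)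

coprime-self⇒≡1 : ∀ {n} → Coprime n n → n ≡ 1
coprime-self⇒≡1 cop = cop (∣-refl , ∣-refl)

-- Numerators of the primitive segment (a/p, b/q) ⊆ [0,1]; lowest terms and
-- positivity of p and q follow from these fields.
record Numerators (p q : ℕ) : Set where
  constructor numerators
  field
    a b : ℕ
    det : b * p ≡ a * q + 1
    b≤q : b ≤ q

module _ {p q : ℕ} (s : Numerators p q) where
  open Numerators s

  a<p : a < p
  a<p = *-cancelʳ-< q a p (begin-strict
    a * q       <⟨ n<1+n (a * q) ⟩
    suc (a * q) ≡⟨ +-comm 1 (a * q) ⟩
    a * q + 1   ≡⟨ det ⟨
    b * p       ≤⟨ *-monoˡ-≤ p b≤q ⟩
    q * p       ≡⟨ *-comm q p ⟩
    p * q       ∎)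
    where open ≤-Reasoning

  1≤q : 1 ≤ q
  1≤q = ≤-trans (n≢0⇒n>0 b≢0) b≤q
    where
    b≢0 : b ≢ 0
    b≢0 b≡0 = 1+n≢0 (begin
      suc (a * q) ≡⟨ +-comm 1 (a * q) ⟩
      a * q + 1   ≡⟨ det ⟨
      b * p       ≡⟨ cong (_* p) b≡0 ⟩
      0           ∎)
      where open ≡-Reasoning

  ∣b*p∣a*q⇒≡1 : ∀ {d} → d ∣ b * p → d ∣ a * q → d ≡ 1
  ∣b*p∣a*q⇒≡1 {d} d∣bp d∣aq = ∣1⇒≡1 (∣m+n∣m⇒∣n (subst (d ∣_) det d∣bp) d∣aq)

  toPrimSeg01 : PrimSeg01 p q a b
  toPrimSeg01 = m<n⇒0<n a<p , 1≤q , coprime-a-p , coprime-b-q , det , b≤q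
    where
    coprime-a-p : Coprime a p
    coprime-a-p (d∣a , d∣p) = ∣b*p∣a*q⇒≡1 (∣n⇒∣m*n b d∣p) (∣m⇒∣m*n q d∣a)
    coprime-b-q : Coprime b q
    coprime-b-q (d∣b , d∣q) = ∣b*p∣a*q⇒≡1 (∣m⇒∣m*n p d∣b) (∣n⇒∣m*n a d∣q)

unit-numerators : Numerators 1 1
unit-numerators = numerators 0 1 refl ≤-refl

mediantʳ : ∀ {p q} → Numerators p q → Numerators p (p + q)
mediantʳ {p} {q} s@(numerators a b det b≤q) =
  numerators a (a + b) det′ (+-mono-≤ (<⇒≤ (a<p s)) b≤q)
  where
  open ≡-Reasoning
  det′ : (a + b) * p ≡ a * (p + q) + 1
  det′ = begin
    (a + b) * p         ≡⟨ *-distribʳ-+ p a b ⟩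
    a * p + b * p       ≡⟨ cong (_+_ (a * p)) det ⟩
    a * p + (a * q + 1) ≡⟨ solve (a ∷ p ∷ q ∷ []) ⟩
    a * (p + q) + 1     ∎

mediantˡ : ∀ {p q} → Numerators p q → Numerators (p + q) q
mediantˡ {p} {q} (numerators a b det b≤q) = numerators (a + b) b det′ b≤q
  where
  open ≡-Reasoning
  det′ : b * (p + q) ≡ (a + b) * q + 1
  det′ = begin
    b * (p + q)         ≡⟨ *-distribˡ-+ b p q ⟩
    b * p + b * q       ≡⟨ cong (_+ b * q) det ⟩
    a * q + 1 + b * q   ≡⟨ solve (a ∷ b ∷ q ∷ []) ⟩
    (a + b) * q + 1     ∎

coprime⇒numerators : ∀ {p q} → 1 ≤ p → 1 ≤ q → Coprime p q → Numerators p q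
coprime⇒numerators 1≤p 1≤q cop = descend 1≤p 1≤q cop (<-wellFounded _)
  where
  descend : ∀ {p q} → 1 ≤ p → 1 ≤ q → Coprime p q → Acc _<_ (p + q) → Numerators p q
  descend {p} {q} 1≤p 1≤q cop (acc rec) with compare p q
  ... | equal p with coprime-self⇒≡1 cop
  ...   | refl = unit-numerators
  descend 1≤p 1≤q cop (acc rec) | less p k =
    subst (Numerators p) p+[1+k]≡q (mediantʳ (descend 1≤p (s≤s z≤n) cop′ (rec smaller)))
    where
    p+[1+k]≡q : p + suc k ≡ suc (p + k)
    p+[1+k]≡q = +-suc p k
    cop′ : Coprime p (suc k)
    cop′ = coprime-+⁻¹ˡ (subst (Coprime p) (≡.sym p+[1+k]≡q) cop)
    smaller : p + suc k < p + suc (p + k)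
    smaller = +-monoʳ-< p (s≤s (m<n+m k 1≤p))
  descend 1≤p 1≤q cop (acc rec) | greater q k =
    subst (λ p → Numerators p q) [1+k]+q≡p (mediantˡ (descend (s≤s z≤n) 1≤q cop′ (rec smaller)))
    where
    [1+k]+q≡p : suc k + q ≡ suc (q + k)
    [1+k]+q≡p = cong suc (+-comm k q)
    cop′ : Coprime (suc k) q
    cop′ = coprime-+⁻¹ʳ (subst (λ p → Coprime p q) (≡.sym [1+k]+q≡p) cop)
    smaller : suc k + q < suc (q + k) + q
    smaller = +-monoˡ-< q (s≤s (m<n+m k 1≤q))

module _ {c ℓ} (W : AbelianGroup c ℓ) {μ : P1 → P1 → AbelianGroup.Carrier W} (pm : IsPseudoMeasure W μ) where
  open AbelianGroup W
  open IsPseudoMeasure pm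
  open SetoidReasoning setoid

  chasles : ∀ α β γ → μ α β ∙ μ β γ ≈ μ α γ
  chasles α β γ = ∙-cancelʳ (μ γ α) _ _ (trans (cocyc α β γ) (sym (antis α γ)))
    where open GroupProperties group using (∙-cancelʳ)

  module _ (n : ℤ) {R : ℕ → ℕ → Carrier} (isR : IsRμn W μ n R) where

    point : ℕ → ℕ → P1
    point a p = fin (ℤ→ℚ n +ℚ frac (+ a) p)

    R≈μ : ∀ {p q} (s : Numerators p q) → R p q ≈ μ (point (Numerators.a s) p) (point (Numerators.b s) q)
    R≈μ s = isR _ _ _ _ (toPrimSeg01 s)

    reciprocity : IsReciprocity W R
    reciprocity p q (1≤p , 1≤q , cop) = begin
      R (p + q) q ∙ R p (p + q) ≈⟨ ∙-cong (R≈μ (mediantˡ s)) (R≈μ (mediantʳ s)) ⟩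
      μ m β ∙ μ α m             ≈⟨ comm _ _ ⟩
      μ α m ∙ μ m β             ≈⟨ chasles α m β ⟩
      μ α β                     ≈⟨ R≈μ s ⟨
      R p q                     ∎
      where
      s : Numerators p q
      s = coprime⇒numerators 1≤p 1≤q cop
      open Numerators s
      α β m : P1
      α = point a p
      β = point b q
      m = point (a + b) (p + q)

    R11≈μ[n,n+1] : R 1 1 ≈ μ (fin (ℤ→ℚ n)) (fin (ℤ→ℚ n +ℚ + 1 / 1))
    R11≈μ[n,n+1] = begin
      R 1 1                                     ≈⟨ R≈μ unit-numerators ⟩
      μ (point 0 1) (point 1 1)                 ≡⟨ cong (λ x → μ (fin x) (point 1 1)) (ℚ.+-identityʳ (ℤ→ℚ n)) ⟩
      μ (fin (ℤ→ℚ n)) (fin (ℤ→ℚ n +ℚ + 1 / 1)) ∎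

proposition1p9p2 : ∀ {c ℓ} (W : AbelianGroup c ℓ) (μ : P1 → P1 → AbelianGroup.Carrier W)
    → IsPseudoMeasure W μ
    → (n : ℤ) (R : ℕ → ℕ → AbelianGroup.Carrier W)
    → IsRμn W μ n R
    → IsReciprocity W R
      × ((AbelianGroup._≈_ W (R 1 1) (AbelianGroup.ε W)
          → AbelianGroup._≈_ W (μ (fin (ℤ→ℚ n)) (fin (ℤ→ℚ n +ℚ + 1 / 1))) (AbelianGroup.ε W))
        × (AbelianGroup._≈_ W (μ (fin (ℤ→ℚ n)) (fin (ℤ→ℚ n +ℚ + 1 / 1))) (AbelianGroup.ε W)
          → AbelianGroup._≈_ W (R 1 1) (AbelianGroup.ε W)))
proposition1p9p2 W μ pm n R isR =
  reciprocity W pm n isR , trans (sym (R11≈μ[n,n+1] W pm n isR)) , trans (R11≈μ[n,n+1] W pm n isR)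
  where open AbelianGroup W using (trans; sym)
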